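{- Let $k \ge 0$ be an integer, and let $\ell$ be an integer with $1 \le \ell \le 2(4k+3)$ and $\gcd(\ell, 4k+3) = 1$. Put $$M = \frac{16\,\ell\,(4k+3) - 4\ell^{2}}{(\gcd(\ell,4))^{2}}.$$ Let $n$ be a positive integer with $(4k+3)n \equiv -1 \pmod M$, and let $p$ be a prime with $p \equiv n \pmod M$. Then $$\frac{4}{p} = \frac{4(4k+3)-\ell}{(4k+3)p+1} + \frac{\ell}{(4k+3)p+1} + \frac{4}{p\big((4k+3)p+1\big)},$$ and each of the three fractions on the right is a unit fraction, i.e. of the form $1/N$ for a positive integer $N$. Hence this gives a solution $\frac{4}{p} = \frac{1}{x}+\frac{1}{y}+\frac{1}{z}$ in positive integers. -}

module Defs where

open import Data.Nat using (ℕ; zero; suc; _+_; _*_; _∸_; NonZero)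
open import Data.Nat.DivMod using (_/_)
open import Data.Nat.GCD using (gcd)
open import Data.Integer using (ℤ; +_)
open import Data.Product using (∃-syntax; Σ-syntax)
open import Relation.Binary.PropositionalEquality using (_≡_)
import Data.Rational as ℚ
open ℚ using (ℚ)

q : ℕ → ℕ
q k = 4 * k + 3

*-nonZero : (m n : ℕ) → .{{NonZero m}} → .{{NonZero n}} → NonZero (m * n)
*-nonZero (suc m) (suc n) = _

gcd4-nonZero : (ℓ : ℕ) → NonZero (gcd ℓ 4)
gcd4-nonZero ℓ with gcd ℓ 4 in eq
... | suc _ = _
... | zero with Data.Nat.GCD.gcd[m,n]≡0⇒n≡0 ℓ {4} eq
...   | ()
  where import Data.Nat.GCD

gcdSq-nonZero : (ℓ : ℕ) → NonZero (gcd ℓ 4 * gcd ℓ 4)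
gcdSq-nonZero ℓ = *-nonZero (gcd ℓ 4) (gcd ℓ 4) {{gcd4-nonZero ℓ}} {{gcd4-nonZero ℓ}}

-- M = (16 ℓ q - 4 ℓ²) / gcd(ℓ,4)²   (the truncated subtraction is exact
-- under the hypothesis ℓ ≤ 2q, since then 4ℓ² ≤ 16ℓq)
M : (k ℓ : ℕ) → ℕ
M k ℓ = ((16 * ℓ * q k ∸ 4 * ℓ * ℓ) / (gcd ℓ 4 * gcd ℓ 4)) {{gcdSq-nonZero ℓ}}

IsUnitFraction : ℚ → Set
IsUnitFraction x = ∃[ N ] Σ[ nz ∈ NonZero N ] x ≡ ℚ._/_ (+ 1) N {{nz}}

-- Write D = 1 + qp. Since D = q(p − n) + (qn + 1), the congruence hypotheses give M ∣ D.
-- With g = gcd(ℓ,4) one has M = 4ℓ(4q − ℓ)/g², and as g divides each of 4, ℓ and 4q − ℓ,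
-- each of these three numbers divides M, hence D. This makes ℓ/D, (4q − ℓ)/D and 4/(pD)
-- unit fractions, while the decomposition of 4/p itself is the identity
-- 4/p = 4q/D + 4/(pD), valid for every p.
module Submission where

open import Defs
open import Data.Nat using (ℕ; suc; _≤_; _*_; _+_; _∸_; NonZero; ≢-nonZero⁻¹)
open import Data.Nat.GCD using (gcd; gcd[m,n]∣m; gcd[m,n]∣n)
open import Data.Nat.Primality using (Prime; prime⇒nonZero)
open import Data.Integer using (+_; _-_)
open import Data.Integer.Divisibility using (_∣_)
open import Data.Product using (_×_; _,_)
open import Relation.Binary.PropositionalEquality
  using (_≡_; refl; sym; trans; cong; cong₂; subst; module ≡-Reasoning)
import Data.Rational as ℚ

import Data.Nat.Properties as ℕ
open import Data.Nat.Divisibility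
  using (divides; ∣-trans; ∣m⇒∣m*n; ∣n⇒∣m*n) renaming (_∣_ to _∣ℕ_)
open import Data.Nat.DivMod using (_/_; /-congˡ; m*n/n≡m)
import Data.Nat.Tactic.RingSolver as ℕ-Solver
import Data.Integer.Tactic.RingSolver as ℤ-Solver
import Data.Integer as ℤ
import Data.Integer.Properties as ℤ
import Data.Integer.Divisibility.Signed as ℤ
open import Data.Rational using (toℚᵘ)
open import Data.Rational.Properties
  using (fromℚᵘ-cong; toℚᵘ-injective; toℚᵘ-homo-+; toℚᵘ-fromℚᵘ)
open import Data.Rational.Unnormalised as ℚᵘ using (*≡*)
import Data.Rational.Unnormalised.Properties as ℚᵘ
open import Relation.Nullary using (contradiction)

/-cross-cong : ∀ a b c d .{{_ : NonZero b}} .{{_ : NonZero d}} →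
               a * d ≡ c * b → + a ℚ./ b ≡ + c ℚ./ d
/-cross-cong a 0 c d = contradiction refl (≢-nonZero⁻¹ 0)
/-cross-cong a (suc _) c 0 = contradiction refl (≢-nonZero⁻¹ 0)
/-cross-cong a b@(suc _) c d@(suc _) ad≡cb =
  fromℚᵘ-cong {+ a ℚᵘ./ b} {+ c ℚᵘ./ d}
    (*≡* (trans (sym (ℤ.pos-* a d)) (trans (cong +_ ad≡cb) (ℤ.pos-* c b))))

/-+-/ : ∀ a b c d .{{_ : NonZero b}} .{{_ : NonZero d}} →
        + a ℚ./ b ℚ.+ + c ℚ./ d ≡ ℚ._/_ (+ (a * d + c * b)) (b * d) {{ℕ.m*n≢0 b d}}
/-+-/ a 0 c d = contradiction refl (≢-nonZero⁻¹ 0)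
/-+-/ a (suc _) c 0 = contradiction refl (≢-nonZero⁻¹ 0)
/-+-/ a b@(suc _) c d@(suc _) = toℚᵘ-injective (begin
  toℚᵘ (+ a ℚ./ b ℚ.+ + c ℚ./ d)
    ≈⟨ toℚᵘ-homo-+ (+ a ℚ./ b) (+ c ℚ./ d) ⟩
  toℚᵘ (+ a ℚ./ b) ℚᵘ.+ toℚᵘ (+ c ℚ./ d)
    ≈⟨ ℚᵘ.+-cong (toℚᵘ-fromℚᵘ (+ a ℚᵘ./ b)) (toℚᵘ-fromℚᵘ (+ c ℚᵘ./ d)) ⟩
  (+ a ℤ.* + d ℤ.+ + c ℤ.* + b) ℚᵘ./ (b * d)
    ≡⟨ cong (ℚᵘ._/ (b * d)) numerator ⟩
  + (a * d + c * b) ℚᵘ./ (b * d)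
    ≈⟨ ℚᵘ.≃-sym (toℚᵘ-fromℚᵘ (+ (a * d + c * b) ℚᵘ./ (b * d))) ⟩
  toℚᵘ (+ (a * d + c * b) ℚ./ (b * d))
    ∎)
  where
  open ℚᵘ.≃-Reasoning
  numerator : + a ℤ.* + d ℤ.+ + c ℤ.* + b ≡ + (a * d + c * b)
  numerator = sym (trans (ℤ.pos-+ (a * d) (c * b)) (cong₂ ℤ._+_ (ℤ.pos-* a d) (ℤ.pos-* c b)))

/-split : ∀ c Q p a b .{{_ : NonZero p}} → a + b ≡ c * Q →
          + c ℚ./ p ≡ + a ℚ./ (1 + Q * p) ℚ.+ + b ℚ./ (1 + Q * p)
                      ℚ.+ ℚ._/_ (+ c) (p * (1 + Q * p)) {{ℕ.m*n≢0 p (1 + Q * p)}}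
/-split c Q p a b a+b≡cQ = sym (begin
  + a ℚ./ D ℚ.+ + b ℚ./ D ℚ.+ + c ℚ./ (p * D)
    ≡⟨ cong (ℚ._+ + c ℚ./ (p * D)) (/-+-/ a D b D) ⟩
  + (a * D + b * D) ℚ./ (D * D) ℚ.+ + c ℚ./ (p * D)
    ≡⟨ /-+-/ (a * D + b * D) (D * D) c (p * D) ⟩
  + ((a * D + b * D) * (p * D) + c * (D * D)) ℚ./ (D * D * (p * D))
    ≡⟨ /-cross-cong ((a * D + b * D) * (p * D) + c * (D * D)) (D * D * (p * D)) c p cross ⟩
  + c ℚ./ p
    ∎)
  where
  open ≡-Reasoning
  D = 1 + Q * p
  instance
    DD≢0 : NonZero (D * D)
    DD≢0 = ℕ.m*n≢0 D D
    pD≢0 : NonZero (p * D)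
    pD≢0 = ℕ.m*n≢0 p D
    DDpD≢0 : NonZero (D * D * (p * D))
    DDpD≢0 = ℕ.m*n≢0 (D * D) (p * D)
  identity : ∀ c Q p → (c * Q * (1 + Q * p) * (p * (1 + Q * p)) + c * ((1 + Q * p) * (1 + Q * p))) * p
                     ≡ c * ((1 + Q * p) * (1 + Q * p) * (p * (1 + Q * p)))
  identity = ℕ-Solver.solve-∀
  cross : ((a * D + b * D) * (p * D) + c * (D * D)) * p ≡ c * (D * D * (p * D))
  cross = trans (cong (λ x → (x * (p * D) + c * (D * D)) * p)
                      (trans (sym (ℕ.*-distribʳ-+ D a b)) (cong (_* D) a+b≡cQ)))
                (identity c Q p)

∣⇒IsUnitFraction : ∀ {a n} .{{_ : NonZero n}} → a ∣ℕ n → IsUnitFraction (+ a ℚ./ n)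
∣⇒IsUnitFraction {a} {n} (divides 0 n≡0) = contradiction n≡0 (≢-nonZero⁻¹ n)
∣⇒IsUnitFraction {a} {n} (divides x@(suc _) n≡xa) =
  x , _ , /-cross-cong a n 1 x (trans (ℕ.*-comm a x) (trans (sym n≡xa) (sym (ℕ.*-identityˡ n))))

∣m⇒∣n⇒∣m∸n : ∀ {d m n} → d ∣ℕ m → d ∣ℕ n → d ∣ℕ m ∸ n
∣m⇒∣n⇒∣m∸n {d} (divides i refl) (divides j refl) = divides (i ∸ j) (sym (ℕ.*-distribʳ-∸ d i j))

m∣m*n*o/d² : ∀ m {n o d} .{{_ : NonZero d}} → d ∣ℕ n → d ∣ℕ o →
             m ∣ℕ (m * n * o / (d * d)) {{ℕ.m*n≢0 d d}}
m∣m*n*o/d² m {d = d} (divides n refl) (divides o refl) = divides (n * o) (begin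
  m * (n * d) * (o * d) / (d * d)  ≡⟨ /-congˡ {o = d * d} (rearrange m n o d) ⟩
  n * o * m * (d * d) / (d * d)    ≡⟨ m*n/n≡m (n * o * m) (d * d) ⟩
  n * o * m                        ∎)
  where
  open ≡-Reasoning
  instance
    dd≢0 : NonZero (d * d)
    dd≢0 = ℕ.m*n≢0 d d
  rearrange : ∀ m n o d → m * (n * d) * (o * d) ≡ n * o * m * (d * d)
  rearrange = ℕ-Solver.solve-∀

M≡4ℓ[4q∸ℓ]/gcd² : ∀ k ℓ →
                  M k ℓ ≡ (4 * ℓ * (4 * q k ∸ ℓ) / (gcd ℓ 4 * gcd ℓ 4)) {{gcdSq-nonZero ℓ}}
M≡4ℓ[4q∸ℓ]/gcd² k ℓ = /-congˡ {o = gcd ℓ 4 * gcd ℓ 4} {{gcdSq-nonZero ℓ}} (begin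
  16 * ℓ * q k ∸ 4 * ℓ * ℓ       ≡⟨ cong (_∸ 4 * ℓ * ℓ) (regroup ℓ (q k)) ⟩
  4 * ℓ * (4 * q k) ∸ 4 * ℓ * ℓ  ≡⟨ ℕ.*-distribˡ-∸ (4 * ℓ) (4 * q k) ℓ ⟨
  4 * ℓ * (4 * q k ∸ ℓ)          ∎)
  where
  open ≡-Reasoning
  regroup : ∀ ℓ Q → 16 * ℓ * Q ≡ 4 * ℓ * (4 * Q)
  regroup = ℕ-Solver.solve-∀

module _ (k ℓ : ℕ) where
  private
    g = gcd ℓ 4
    A = 4 * q k ∸ ℓ
    instance
      g≢0 : NonZero g
      g≢0 = gcd4-nonZero ℓ
    g∣ℓ : g ∣ℕ ℓ
    g∣ℓ = gcd[m,n]∣m ℓ 4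
    g∣4 : g ∣ℕ 4
    g∣4 = gcd[m,n]∣n ℓ 4
    g∣A : g ∣ℕ A
    g∣A = ∣m⇒∣n⇒∣m∸n (∣m⇒∣m*n (q k) g∣4) g∣ℓ
    factor∣M : ∀ x y z → x * y * z ≡ 4 * ℓ * A → g ∣ℕ y → g ∣ℕ z → x ∣ℕ M k ℓ
    factor∣M x y z xyz≡4ℓA g∣y g∣z = subst (x ∣ℕ_)
      (trans (/-congˡ {o = g * g} {{gcdSq-nonZero ℓ}} xyz≡4ℓA) (sym (M≡4ℓ[4q∸ℓ]/gcd² k ℓ)))
      (m∣m*n*o/d² x g∣y g∣z)
    rotate : ∀ x y z → x * y * z ≡ y * z * x
    rotate = ℕ-Solver.solve-∀

  4∣M : 4 ∣ℕ M k ℓ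
  4∣M = factor∣M 4 ℓ A refl g∣ℓ g∣A

  ℓ∣M : ℓ ∣ℕ M k ℓ
  ℓ∣M = factor∣M ℓ 4 A (cong (_* A) (ℕ.*-comm ℓ 4)) g∣4 g∣A

  4q∸ℓ∣M : 4 * q k ∸ ℓ ∣ℕ M k ℓ
  4q∸ℓ∣M = factor∣M A 4 ℓ (rotate A 4 ℓ) g∣4 g∣ℓ

∣1+Q*p : ∀ m Q n p → + m ∣ + (Q * n) ℤ.+ + 1 → + m ∣ + p - + n → m ∣ℕ 1 + Q * p
∣1+Q*p m Q n p m∣Qn+1 m∣p-n = ℤ.∣⇒∣ᵤ (subst (ℤ._∣_ (+ m)) Q[p-n]+[Qn+1]≡1+Qp
  (ℤ.∣m∣n⇒∣m+n (ℤ.∣n⇒∣m*n (+ Q) (ℤ.∣ᵤ⇒∣ m∣p-n)) (ℤ.∣ᵤ⇒∣ m∣Qn+1)))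
  where
  open ≡-Reasoning
  identity : ∀ Q p n → Q ℤ.* (p ℤ.- n) ℤ.+ (Q ℤ.* n ℤ.+ ℤ.1ℤ) ≡ ℤ.1ℤ ℤ.+ Q ℤ.* p
  identity = ℤ-Solver.solve-∀
  Q[p-n]+[Qn+1]≡1+Qp : + Q ℤ.* (+ p - + n) ℤ.+ (+ (Q * n) ℤ.+ + 1) ≡ + (1 + Q * p)
  Q[p-n]+[Qn+1]≡1+Qp = begin
    + Q ℤ.* (+ p - + n) ℤ.+ (+ (Q * n) ℤ.+ + 1)
      ≡⟨ cong (λ x → + Q ℤ.* (+ p - + n) ℤ.+ (x ℤ.+ + 1)) (ℤ.pos-* Q n) ⟩
    + Q ℤ.* (+ p - + n) ℤ.+ (+ Q ℤ.* + n ℤ.+ + 1)  ≡⟨ identity (+ Q) (+ p) (+ n) ⟩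
    + 1 ℤ.+ + Q ℤ.* + p                            ≡⟨ cong (ℤ._+_ ℤ.1ℤ) (ℤ.pos-* Q p) ⟨
    + (1 + Q * p)                                  ∎

lemma1 : (k ℓ n p : ℕ) → 1 ≤ ℓ → ℓ ≤ 2 * q k → gcd ℓ (q k) ≡ 1
       → 1 ≤ n → (+ M k ℓ) ∣ (+ (q k * n) Data.Integer.+ + 1)
       → (pp : Prime p) → (+ M k ℓ) ∣ (+ p - + n)
       → (ℚ._/_ (+ 4) p {{prime⇒nonZero pp}}
            ≡ ((+ (4 * q k) - + ℓ) ℚ./ (1 + q k * p))
              ℚ.+ ((+ ℓ) ℚ./ (1 + q k * p))
              ℚ.+ ℚ._/_ (+ 4) (p * (1 + q k * p)) {{*-nonZero p (1 + q k * p) {{prime⇒nonZero pp}}}})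
         × IsUnitFraction ((+ (4 * q k) - + ℓ) ℚ./ (1 + q k * p))
         × IsUnitFraction ((+ ℓ) ℚ./ (1 + q k * p))
         × IsUnitFraction (ℚ._/_ (+ 4) (p * (1 + q k * p)) {{*-nonZero p (1 + q k * p) {{prime⇒nonZero pp}}}})
lemma1 k ℓ n p _ ℓ≤2q _ _ M∣qn+1 pp M∣p-n =
    trans (/-split 4 (q k) p A ℓ (ℕ.m∸n+n≡m ℓ≤4q))
          (cong (λ x → x ℚ./ D ℚ.+ + ℓ ℚ./ D ℚ.+ + 4 ℚ./ (p * D)) (sym 4q-ℓ≡A))
  , subst (λ x → IsUnitFraction (x ℚ./ D)) (sym 4q-ℓ≡A)
          (∣⇒IsUnitFraction (∣-trans (4q∸ℓ∣M k ℓ) M∣D))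
  , ∣⇒IsUnitFraction (∣-trans (ℓ∣M k ℓ) M∣D)
  , ∣⇒IsUnitFraction (∣n⇒∣m*n p (∣-trans (4∣M k ℓ) M∣D))
  where
  D = 1 + q k * p
  A = 4 * q k ∸ ℓ
  instance
    p≢0 : NonZero p
    p≢0 = prime⇒nonZero pp
    pD≢0 : NonZero (p * D)
    pD≢0 = ℕ.m*n≢0 p D
  ℓ≤4q : ℓ ≤ 4 * q k
  ℓ≤4q = ℕ.≤-trans ℓ≤2q (ℕ.*-monoˡ-≤ (q k) (ℕ.m≤m+n 2 2))
  4q-ℓ≡A : + (4 * q k) - + ℓ ≡ + A
  4q-ℓ≡A = trans (ℤ.m-n≡m⊖n (4 * q k) ℓ) (ℤ.⊖-≥ ℓ≤4q)
  M∣D : M k ℓ ∣ℕ D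
  M∣D = ∣1+Q*p (M k ℓ) (q k) n p M∣qn+1 M∣p-n
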